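{- Let $q$ be a prime power and $m\ge2$. For a divisor $\ell$ of $m$ with $m/\ell$ even, put $\varepsilon_\ell=(-1)^{\frac12(m/\ell)}$ and $$k_\ell=\frac{q^m-1}{q^\ell+1},\qquad \upsilon_\ell=\frac{\varepsilon_\ell q^{m/2}-1}{q^\ell+1},\qquad \mu_\ell=\frac{ -\varepsilon_\ell q^{\frac m2+\ell}-1}{q^\ell+1}$$ (for $\ell\ne\frac m2$ these are the eigenvalues of $\Gamma_{q,m}(\ell)$), and let $e_\ell=q^mk_\ell/2$ be the number of edges of $\Gamma_{q,m}(\ell)$. Then: (a) $k_\ell=(\varepsilon_\ell q^{m/2}+1)\upsilon_\ell$, $-q^\ell\upsilon_\ell=\mu_\ell+1$, and $\gcd(\upsilon_\ell,\mu_\ell)=1$. (b) For fixed $q$ and $\ell$ and any integer $M$ with $\ell\mid M$, the value of $\upsilon_\ell$ computed with $m=2M+2\ell$ equals the value of $\mu_\ell$ computed with $m=2M$. (c) If $d$ and $\ell$ are divisors of $m$ with $m/d$ and $m/\ell$ even and $\Gamma_{q,m}(d)$ is a subgraph of $\Gamma_{q,m}(\ell)$, then $k_d\mid k_\ell$, $\upsilon_d\mid\upsilon_\ell$ and $e_d\mid e_\ell$.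
   Context: $S_{q,m}(\ell)=\{x^{q^\ell+1}:x\in\mathbb F_{q^m}^*\}$ and $\Gamma_{q,m}(\ell)$ is the Cayley graph with vertex set $\mathbb F_{q^m}$ and $x\sim y$ iff $y-x\in S_{q,m}(\ell)$. -}

module Defs where

open import Data.Nat as ℕ using (ℕ; zero; suc; NonZero; _≤_)
open import Data.Nat.DivMod as ℕD using ()
open import Data.Nat.Divisibility as ℕDiv using ()
open import Data.Nat.Primality using (Prime)
open import Data.Integer as ℤ using (ℤ; +_; 1ℤ)
open import Data.Integer.DivMod using (_/ℕ_)
open import Data.Fin using (Fin)
open import Data.Product using (Σ; ∃; _×_)
open import Relation.Binary.PropositionalEquality using (_≡_)
open import Relation.Nullary using (¬_)
open import Algebra.Structures using (IsCommutativeRing)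
open import Function.Bundles using (_↔_)

IsPrimePower : ℕ → Set
IsPrimePower q = Σ ℕ λ p → Σ ℕ λ n → Prime p × (1 ≤ n) × (q ≡ p ℕ.^ n)

negOnePow : ℕ → ℤ
negOnePow zero = 1ℤ
negOnePow (suc n) = ℤ.- negOnePow n

eps : (q m ℓ : ℕ) → .{{NonZero ℓ}} → ℤ
eps q m ℓ = negOnePow ((m ℕD./ ℓ) ℕD./ 2)

-- k_ℓ = (q^m - 1)/(q^ℓ + 1)   (exact division under the paper's hypotheses)
kval : (q m ℓ : ℕ) → ℤ
kval q m ℓ = (+ (q ℕ.^ m) ℤ.- 1ℤ) /ℕ suc (q ℕ.^ ℓ)

upsilon : (q m ℓ : ℕ) → .{{NonZero ℓ}} → ℤ
upsilon q m ℓ = (eps q m ℓ ℤ.* + (q ℕ.^ (m ℕD./ 2)) ℤ.- 1ℤ) /ℕ suc (q ℕ.^ ℓ)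

mu : (q m ℓ : ℕ) → .{{NonZero ℓ}} → ℤ
mu q m ℓ = (ℤ.- (eps q m ℓ ℤ.* + (q ℕ.^ (m ℕD./ 2 ℕ.+ ℓ))) ℤ.- 1ℤ) /ℕ suc (q ℕ.^ ℓ)

edges : (q m ℓ : ℕ) → ℤ
edges q m ℓ = (+ (q ℕ.^ m) ℤ.* kval q m ℓ) /ℕ 2

record FiniteField (N : ℕ) : Set₁ where
  field
    Carrier : Set
    _+_ _*_ : Carrier → Carrier → Carrier
    -_ : Carrier → Carrier
    0# 1# : Carrier
    isCommutativeRing : IsCommutativeRing _≡_ _+_ _*_ -_ 0# 1#
    0≢1 : ¬ (0# ≡ 1#)
    inverse : ∀ x → ¬ (x ≡ 0#) → ∃ λ y → (x * y) ≡ 1#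
    card : Carrier ↔ Fin N

  _-_ : Carrier → Carrier → Carrier
  x - y = x + (- y)

  _^_ : Carrier → ℕ → Carrier
  x ^ zero = 1#
  x ^ suc n = x * (x ^ n)

  InS : (q ℓ : ℕ) → Carrier → Set
  InS q ℓ y = ∃ λ x → ¬ (x ≡ 0#) × (y ≡ x ^ (q ℕ.^ ℓ ℕ.+ 1))

  -- adjacency in the Cayley graph Γ_{q,m}(ℓ): x ∼ y iff y - x ∈ S_{q,m}(ℓ)
  Adj : (q ℓ : ℕ) → Carrier → Carrier → Set
  Adj q ℓ x y = InS q ℓ (y - x)

IsSubgraph : ∀ {N} (F : FiniteField N) (q d ℓ : ℕ) → Set
IsSubgraph F q d ℓ = ∀ x y → Adj q d x y → Adj q ℓ x y
  where open FiniteField F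

-- Write m = 2tℓ and B = q^ℓ. Then ε_ℓ q^(m/2) = (−B)^t =: X, and the geometric series
-- X − 1 = −(1 + B)·Σ_{i<t} (−B)^i shows υ_ℓ = −Σ_{i<t} (−B)^i, k_ℓ = (X + 1)υ_ℓ and
-- μ_ℓ = −Bυ_ℓ − 1; this gives (a), and (b) is the recursion of the geometric sum in t.
-- For (c), the subgraph hypothesis makes every (q^d + 1)-th power in F* a (q^ℓ + 1)-th
-- power. As q^ℓ + 1 divides |F*| = q^m − 1, Fermat's little theorem and the root bound for
-- polynomials force q^ℓ + 1 ∣ q^d + 1. The two signs ε_d, ε_ℓ then agree (otherwise
-- q^ℓ + 1 would divide 2), and υ_ℓ, k_ℓ, e_ℓ are (q^d + 1)/(q^ℓ + 1) times υ_d, k_d, e_d.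

module Submission where

open import Defs
open import Data.Nat as ℕ using (ℕ; NonZero; zero; suc; _≤_)
import Data.Nat.Properties as ℕP
open import Data.Nat.DivMod as ℕD using ()
open import Data.Nat.Divisibility as ℕDiv using (divides; _∣_)
open import Data.Nat.Primality using (prime⇒nonTrivial)
import Data.Nat.Tactic.RingSolver as ℕSolver
open import Data.Integer as ℤ using (ℤ)
import Data.Integer.Properties as ℤP
open import Data.Integer.DivMod using (_/ℕ_)
open import Data.Integer.Tactic.RingSolver using (solve-∀)
open import Data.Integer.Divisibility as ℤDiv using ()
import Data.Integer.Divisibility.Signed as ℤS
open import Data.Integer.GCD as ℤG using ()
open import Data.Fin as Fin using (Fin; punchIn; punchOut)
import Data.Fin.Properties as FinP
open import Data.Fin.Permutation using (permutation)
open import Data.Vec using (Vec; []; _∷_)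
open import Data.Vec.Functional using (replicate)
open import Data.Maybe using (nothing)
open import Data.Product using (∃; _×_; _,_; proj₁; proj₂)
open import Data.Sum using (_⊎_; inj₁; inj₂)
open import Data.Empty using (⊥-elim)
open import Level using (0ℓ)
open import Algebra.Bundles using (CommutativeRing)
open import Function using (_∘_)
open import Function.Bundles using (Inverse)
open import Function.Definitions using (Injective)
open import Relation.Nullary using (Dec; yes; no; map′)
open import Relation.Binary.PropositionalEquality
open import Tactic.RingSolver.Core.AlmostCommutativeRing using (fromCommutativeRing)

module FiniteFieldFacts {n : ℕ} (F : FiniteField (suc n)) where
  open FiniteField F using (0≢1; inverse; card; isCommutativeRing)

  ring : CommutativeRing 0ℓ 0ℓ
  ring = record { isCommutativeRing = isCommutativeRing }

  open CommutativeRing ring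
    using ( Carrier; _+_; _*_; -_; _-_; 0#; 1#; *-assoc; *-comm; *-identityˡ; *-identityʳ
          ; zeroˡ; zeroʳ; +-identityˡ; +-identityʳ; -‿inverseʳ; -‿inverseˡ
          ; +-group; commutativeSemiring; *-commutativeMonoid )
  open import Algebra.Properties.Group +-group using (ε⁻¹≈ε)
  open import Algebra.Properties.CommutativeSemiring.Exp commutativeSemiring using (_^_; ^-homo-*; ^-assocʳ)
  open import Algebra.Properties.CommutativeMonoid.Sum *-commutativeMonoid
    using (sum-cong-≗; sum-replicate; ∑-distrib-+; sum-permute) renaming (sum to product)
  open import Tactic.RingSolver.NonReflective (fromCommutativeRing ring (λ _ → nothing))
    using (solve; _⊜_; _⊕_; _⊗_)

  open ≡-Reasoning

  1≢0 : 1# ≢ 0#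
  1≢0 1≡0 = 0≢1 (sym 1≡0)

  *-cancelʳ-≢0 : ∀ {a b w} → w ≢ 0# → a * w ≡ b * w → a ≡ b
  *-cancelʳ-≢0 {a} {b} {w} w≢0 aw≡bw with inverse w w≢0
  ... | w⁻¹ , ww⁻¹≡1 = begin
    a               ≡⟨ undo a ⟩
    (a * w) * w⁻¹   ≡⟨ cong (_* w⁻¹) aw≡bw ⟩
    (b * w) * w⁻¹   ≡⟨ undo b ⟨
    b               ∎
    where
    undo : ∀ c → c ≡ (c * w) * w⁻¹
    undo c = begin
      c               ≡⟨ *-identityʳ c ⟨
      c * 1#          ≡⟨ cong (c *_) ww⁻¹≡1 ⟨
      c * (w * w⁻¹)   ≡⟨ *-assoc c w w⁻¹ ⟨
      (c * w) * w⁻¹   ∎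

  x*y≢0 : ∀ {x y} → x ≢ 0# → y ≢ 0# → x * y ≢ 0#
  x*y≢0 {x} {y} x≢0 y≢0 xy≡0 = y≢0 (*-cancelʳ-≢0 x≢0 (trans (*-comm y x) (trans xy≡0 (sym (zeroˡ x)))))

  1^k≡1 : ∀ k → 1# ^ k ≡ 1#
  1^k≡1 zero    = refl
  1^k≡1 (suc k) = trans (*-identityˡ (1# ^ k)) (1^k≡1 k)

  ^-agrees : ∀ x k → FiniteField._^_ F x k ≡ x ^ k
  ^-agrees x zero    = refl
  ^-agrees x (suc k) = cong (x *_) (^-agrees x k)

  to : Carrier → Fin (suc n)
  to = Inverse.to card

  from : Fin (suc n) → Carrier
  from = Inverse.from card

  to-injective : Injective _≡_ _≡_ to
  to-injective {x} {y} eq = begin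
    x            ≡⟨ Inverse.strictlyInverseʳ card x ⟨
    from (to x)  ≡⟨ cong from eq ⟩
    from (to y)  ≡⟨ Inverse.strictlyInverseʳ card y ⟩
    y            ∎

  -- punchIn skips the index of 0#, so nonzero enumerates F* by Fin n.
  nonzero : Fin n → Carrier
  nonzero i = from (punchIn (to 0#) i)

  nonzero-≢0 : ∀ i → nonzero i ≢ 0#
  nonzero-≢0 i eq = FinP.punchInᵢ≢i (to 0#) i (trans (sym (Inverse.strictlyInverseˡ card _)) (cong to eq))

  nonzero-injective : Injective _≡_ _≡_ nonzero
  nonzero-injective {i} {j} eq =
    FinP.punchIn-injective (to 0#) i j
      (trans (sym (Inverse.strictlyInverseˡ card _)) (trans (cong to eq) (Inverse.strictlyInverseˡ card _)))

  index : ∀ y → y ≢ 0# → Fin n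
  index y y≢0 = punchOut {i = to 0#} {j = to y} (λ eq → y≢0 (to-injective (sym eq)))

  nonzero-index : ∀ y (y≢0 : y ≢ 0#) → nonzero (index y y≢0) ≡ y
  nonzero-index y y≢0 = trans (cong from (FinP.punchIn-punchOut _)) (Inverse.strictlyInverseʳ card y)

  scale : ∀ x → x ≢ 0# → Fin n → Fin n
  scale x x≢0 i = index (x * nonzero i) (x*y≢0 x≢0 (nonzero-≢0 i))

  nonzero-scale : ∀ x (x≢0 : x ≢ 0#) i → nonzero (scale x x≢0 i) ≡ x * nonzero i
  nonzero-scale x x≢0 i = nonzero-index (x * nonzero i) (x*y≢0 x≢0 (nonzero-≢0 i))

  scale-inverse : ∀ {x y} (x≢0 : x ≢ 0#) (y≢0 : y ≢ 0#) → y * x ≡ 1# →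
                  ∀ i → scale y y≢0 (scale x x≢0 i) ≡ i
  scale-inverse {x} {y} x≢0 y≢0 yx≡1 i = nonzero-injective (begin
    nonzero (scale y y≢0 (scale x x≢0 i))  ≡⟨ nonzero-scale y y≢0 _ ⟩
    y * nonzero (scale x x≢0 i)            ≡⟨ cong (y *_) (nonzero-scale x x≢0 i) ⟩
    y * (x * nonzero i)                    ≡⟨ *-assoc y x _ ⟨
    (y * x) * nonzero i                    ≡⟨ cong (_* nonzero i) yx≡1 ⟩
    1# * nonzero i                         ≡⟨ *-identityˡ _ ⟩
    nonzero i                              ∎)

  product-≢0 : ∀ {k} (f : Fin k → Carrier) → (∀ i → f i ≢ 0#) → product f ≢ 0#
  product-≢0 {zero}  f f≢0 = 1≢0
  product-≢0 {suc k} f f≢0 = x*y≢0 (f≢0 Fin.zero) (product-≢0 (λ i → f (Fin.suc i)) (λ i → f≢0 (Fin.suc i)))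

  x^n≡1 : ∀ x → x ≢ 0# → x ^ n ≡ 1#
  x^n≡1 x x≢0 with inverse x x≢0
  ... | x⁻¹ , xx⁻¹≡1 = *-cancelʳ-≢0 (product-≢0 nonzero nonzero-≢0) (begin
    (x ^ n) * P                            ≡⟨ cong (_* P) (sum-replicate n) ⟨
    product (replicate n x) * P            ≡⟨ ∑-distrib-+ (replicate n x) nonzero ⟨
    product (λ i → x * nonzero i)          ≡⟨ sum-cong-≗ (nonzero-scale x x≢0) ⟨
    product (λ i → nonzero (scale x x≢0 i)) ≡⟨ sum-permute nonzero π ⟨
    P                                      ≡⟨ *-identityˡ P ⟨
    1# * P                                 ∎)
    where
    P = product nonzero
    x⁻¹≢0 : x⁻¹ ≢ 0#
    x⁻¹≢0 x⁻¹≡0 = 1≢0 (trans (sym xx⁻¹≡1) (trans (cong (x *_) x⁻¹≡0) (zeroʳ x)))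
    π = permutation (scale x x≢0) (scale x⁻¹ x⁻¹≢0)
          (scale-inverse x⁻¹≢0 x≢0 xx⁻¹≡1)
          (scale-inverse x≢0 x⁻¹≢0 (trans (*-comm x⁻¹ x) xx⁻¹≡1))

  eval : ∀ {k} → Vec Carrier k → Carrier → Carrier
  eval []      x = 0#
  eval (c ∷ p) x = c + x * eval p x

  divide : ∀ {k} → Carrier → Vec Carrier (suc k) → Vec Carrier k
  divide r (c ∷ [])     = []
  divide r (c ∷ c′ ∷ p) = eval (c′ ∷ p) r ∷ divide r (c′ ∷ p)

  -- p(x) − p(r) = (x − r) q(x), stated without subtraction so that the ring solver never
  -- has to cancel coefficients (it cannot decide equality in an abstract ring).
  remainder-theorem : ∀ {k} r (p : Vec Carrier (suc k)) x →
                      eval p x + r * eval (divide r p) x ≡ x * eval (divide r p) x + eval p r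
  remainder-theorem r (c ∷ []) x = regroup x r c 0#
    where
    regroup : ∀ x r c z → (c + x * z) + r * z ≡ x * z + (c + r * z)
    regroup = solve 4 (λ x r c z → ((c ⊕ x ⊗ z) ⊕ r ⊗ z) ⊜ (x ⊗ z ⊕ (c ⊕ r ⊗ z))) refl
  remainder-theorem r (c ∷ c′ ∷ p) x = begin
    (c + x * P) + r * (E + x * D)  ≡⟨ collect x r c P D E ⟩
    (c + r * E) + x * (P + r * D)  ≡⟨ cong (λ e → (c + r * E) + x * e) (remainder-theorem r (c′ ∷ p) x) ⟩
    (c + r * E) + x * (x * D + E)  ≡⟨ expand x r c D E ⟩
    x * (E + x * D) + (c + r * E)  ∎
    where
    P = eval (c′ ∷ p) x
    D = eval (divide r (c′ ∷ p)) x
    E = eval (c′ ∷ p) r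
    collect : ∀ x r c p d e → (c + x * p) + r * (e + x * d) ≡ (c + r * e) + x * (p + r * d)
    collect = solve 6 (λ x r c p d e → ((c ⊕ x ⊗ p) ⊕ r ⊗ (e ⊕ x ⊗ d))
                                     ⊜ ((c ⊕ r ⊗ e) ⊕ x ⊗ (p ⊕ r ⊗ d))) refl
    expand : ∀ x r c d e → (c + r * e) + x * (x * d + e) ≡ x * (e + x * d) + (c + r * e)
    expand = solve 5 (λ x r c d e → ((c ⊕ r ⊗ e) ⊕ x ⊗ (x ⊗ d ⊕ e))
                                  ⊜ (x ⊗ (e ⊕ x ⊗ d) ⊕ (c ⊕ r ⊗ e))) refl

  _≟_ : (x y : Carrier) → Dec (x ≡ y)
  x ≟ y = map′ to-injective (cong to) (to x FinP.≟ to y)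

  vanishes-everywhere : ∀ {k} (p : Vec Carrier k) (roots : Fin k → Carrier) → Injective _≡_ _≡_ roots →
                        (∀ i → eval p (roots i) ≡ 0#) → ∀ x → eval p x ≡ 0#
  vanishes-everywhere []      roots roots-injective vanish x = refl
  vanishes-everywhere (c ∷ p) roots roots-injective vanish x = begin
    eval (c ∷ p) x                    ≡⟨ +-identityʳ _ ⟨
    eval (c ∷ p) x + 0#               ≡⟨ cong (eval (c ∷ p) x +_) (zeroʳ r) ⟨
    eval (c ∷ p) x + r * 0#           ≡⟨ cong (λ d → eval (c ∷ p) x + r * d) (D≡0 x) ⟨
    eval (c ∷ p) x + r * D x          ≡⟨ remainder-theorem r (c ∷ p) x ⟩
    x * D x + eval (c ∷ p) r          ≡⟨ cong₂ (λ d e → x * d + e) (D≡0 x) (vanish Fin.zero) ⟩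
    x * 0# + 0#                       ≡⟨ +-identityʳ _ ⟩
    x * 0#                            ≡⟨ zeroʳ x ⟩
    0#                                ∎
    where
    r = roots Fin.zero
    D = eval (divide r (c ∷ p))
    r*D≡s*D : ∀ i → r * D (roots (Fin.suc i)) ≡ roots (Fin.suc i) * D (roots (Fin.suc i))
    r*D≡s*D i = begin
      r * D s                       ≡⟨ +-identityˡ _ ⟨
      0# + r * D s                  ≡⟨ cong (λ e → e + r * D s) (vanish (Fin.suc i)) ⟨
      eval (c ∷ p) s + r * D s      ≡⟨ remainder-theorem r (c ∷ p) s ⟩
      s * D s + eval (c ∷ p) r      ≡⟨ cong (s * D s +_) (vanish Fin.zero) ⟩
      s * D s + 0#                  ≡⟨ +-identityʳ _ ⟩
      s * D s                       ∎
      where s = roots (Fin.suc i)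
    D-vanishes : ∀ i → D (roots (Fin.suc i)) ≡ 0#
    D-vanishes i with D (roots (Fin.suc i)) ≟ 0#
    ... | yes D≡0 = D≡0
    ... | no  D≢0 = ⊥-elim (FinP.0≢1+n (roots-injective (*-cancelʳ-≢0 D≢0 (r*D≡s*D i))))
    D≡0 : ∀ y → D y ≡ 0#
    D≡0 = vanishes-everywhere (divide r (c ∷ p)) (roots ∘ Fin.suc)
            (λ eq → FinP.suc-injective (roots-injective eq)) D-vanishes

  monomial : ∀ k → Vec Carrier (suc k)
  monomial zero    = 1# ∷ []
  monomial (suc k) = 0# ∷ monomial k

  eval-monomial : ∀ k x → eval (monomial k) x ≡ x ^ k
  eval-monomial zero    x = trans (cong (1# +_) (zeroʳ x)) (+-identityʳ 1#)
  eval-monomial (suc k) x = trans (+-identityˡ _) (cong (x *_) (eval-monomial k x))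

  -1≢0 : - 1# ≢ 0#
  -1≢0 -1≡0 = 1≢0 (begin
    1#          ≡⟨ +-identityʳ 1# ⟨
    1# + 0#     ≡⟨ cong (1# +_) -1≡0 ⟨
    1# + - 1#   ≡⟨ -‿inverseʳ 1# ⟩
    0#          ∎)

  1≤n : 1 ℕ.≤ n
  1≤n = ℕP.n≢0⇒n>0 n≢0
    where
    unique : ∀ {m} → m ≡ 0 → (i j : Fin (suc m)) → i ≡ j
    unique refl Fin.zero Fin.zero = refl
    n≢0 : n ≢ 0
    n≢0 n≡0 = 0≢1 (to-injective (unique n≡0 (to 0#) (to 1#)))

  exponent-bound : ∀ E → (∀ w → w ≢ 0# → w ^ suc E ≡ 1#) → n ℕ.≤ suc E
  exponent-bound E w^[1+E]≡1 with n ℕ.≤? suc E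
  ... | yes n≤1+E = n≤1+E
  ... | no  n≰1+E = ⊥-elim (-1≢0 (trans (sym P-at-0) (P-vanishes 0#)))
    where
    P : Vec Carrier (suc (suc E))
    P = - 1# ∷ monomial E
    2+E≤n : suc (suc E) ℕ.≤ n
    2+E≤n = ℕP.≰⇒> n≰1+E
    roots : Fin (suc (suc E)) → Carrier
    roots i = nonzero (Fin.inject≤ i 2+E≤n)
    P-vanishes : ∀ x → eval P x ≡ 0#
    P-vanishes = vanishes-everywhere P roots
      (λ eq → FinP.inject≤-injective 2+E≤n 2+E≤n _ _ (nonzero-injective eq))
      (λ i → let w = roots i in begin
        - 1# + w * eval (monomial E) w  ≡⟨ cong (λ e → - 1# + w * e) (eval-monomial E w) ⟩
        - 1# + w ^ suc E                ≡⟨ cong (- 1# +_) (w^[1+E]≡1 w (nonzero-≢0 _)) ⟩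
        - 1# + 1#                       ≡⟨ -‿inverseˡ 1# ⟩
        0#                              ∎)
    P-at-0 : eval P 0# ≡ - 1#
    P-at-0 = trans (cong (- 1# +_) (zeroˡ _)) (+-identityʳ (- 1#))

  ^-periodic : ∀ x → x ≢ 0# → ∀ e s → x ^ (e ℕ.+ n ℕ.* s) ≡ x ^ e
  ^-periodic x x≢0 e s = begin
    x ^ (e ℕ.+ n ℕ.* s)      ≡⟨ ^-homo-* x e (n ℕ.* s) ⟩
    x ^ e * x ^ (n ℕ.* s)    ≡⟨ cong (x ^ e *_) (^-assocʳ x n s) ⟨
    x ^ e * (x ^ n) ^ s      ≡⟨ cong (λ y → x ^ e * y ^ s) (x^n≡1 x x≢0) ⟩
    x ^ e * 1# ^ s           ≡⟨ cong (x ^ e *_) (1^k≡1 s) ⟩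
    x ^ e * 1#               ≡⟨ *-identityʳ _ ⟩
    x ^ e                    ∎

  ^-reduce : ∀ {a b K} .{{_ : NonZero b}} → n ≡ K ℕ.* b →
             ∀ x → x ≢ 0# → x ^ (a ℕ.* K) ≡ x ^ (a ℕD.% b ℕ.* K)
  ^-reduce {a} {b} {K} n≡K*b x x≢0 = begin
    x ^ (a ℕ.* K)                               ≡⟨ cong (λ e → x ^ (e ℕ.* K)) (ℕD.m≡m%n+[m/n]*n a b) ⟩
    x ^ ((a ℕD.% b ℕ.+ s ℕ.* b) ℕ.* K)          ≡⟨ cong (x ^_) (distribute (a ℕD.% b) s b K) ⟩
    x ^ (a ℕD.% b ℕ.* K ℕ.+ K ℕ.* b ℕ.* s)      ≡⟨ cong (λ m → x ^ (a ℕD.% b ℕ.* K ℕ.+ m ℕ.* s)) n≡K*b ⟨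
    x ^ (a ℕD.% b ℕ.* K ℕ.+ n ℕ.* s)            ≡⟨ ^-periodic x x≢0 (a ℕD.% b ℕ.* K) s ⟩
    x ^ (a ℕD.% b ℕ.* K)                        ∎
    where
    s = a ℕD./ b
    distribute : ∀ r s b k → (r ℕ.+ s ℕ.* b) ℕ.* k ≡ r ℕ.* k ℕ.+ k ℕ.* b ℕ.* s
    distribute = ℕSolver.solve-∀

  IsPower : ℕ → Carrier → Set
  IsPower b y = ∃ λ z → z ≢ 0# × y ≡ z ^ b

  powers-annihilated : ∀ {a b K} → n ≡ K ℕ.* b → (∀ w → w ≢ 0# → IsPower b (w ^ a)) →
                       ∀ w → w ≢ 0# → w ^ (a ℕ.* K) ≡ 1#
  powers-annihilated {a} {b} {K} n≡K*b powers w w≢0 with powers w w≢0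
  ... | z , z≢0 , w^a≡z^b = begin
    w ^ (a ℕ.* K)   ≡⟨ ^-assocʳ w a K ⟨
    (w ^ a) ^ K     ≡⟨ cong (_^ K) w^a≡z^b ⟩
    (z ^ b) ^ K     ≡⟨ ^-assocʳ z b K ⟩
    z ^ (b ℕ.* K)   ≡⟨ cong (z ^_) (trans (ℕP.*-comm b K) (sym n≡K*b)) ⟩
    z ^ n           ≡⟨ x^n≡1 z z≢0 ⟩
    1#              ∎

  -- A nonzero remainder r = a mod b would give w^(r·n/b) = 1 on F* with 0 < r·n/b < n.
  powers⇒∣ : ∀ a b .{{_ : NonZero b}} → b ∣ n → (∀ w → w ≢ 0# → IsPower b (w ^ a)) → b ∣ a
  powers⇒∣ a b (divides zero    n≡0)       powers = ⊥-elim (ℕP.<⇒≢ 1≤n (sym n≡0))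
  powers⇒∣ a b (divides (suc K) n≡[1+K]*b) powers with a ℕD.% b in a%b≡r
  ... | zero   = ℕDiv.m%n≡0⇒n∣m a b a%b≡r
  ... | suc r′ = ⊥-elim (ℕP.<⇒≱ r*[1+K]<n (exponent-bound (K ℕ.+ r′ ℕ.* suc K) w^[r*[1+K]]≡1))
    where
    w^[r*[1+K]]≡1 : ∀ w → w ≢ 0# → w ^ (suc r′ ℕ.* suc K) ≡ 1#
    w^[r*[1+K]]≡1 w w≢0 = begin
      w ^ (suc r′ ℕ.* suc K)     ≡⟨ cong (λ r → w ^ (r ℕ.* suc K)) a%b≡r ⟨
      w ^ (a ℕD.% b ℕ.* suc K)   ≡⟨ ^-reduce {a} n≡[1+K]*b w w≢0 ⟨
      w ^ (a ℕ.* suc K)          ≡⟨ powers-annihilated {a} {b} n≡[1+K]*b powers w w≢0 ⟩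
      1#                         ∎
    r*[1+K]<n : suc r′ ℕ.* suc K ℕ.< n
    r*[1+K]<n = subst (suc r′ ℕ.* suc K ℕ.<_) (trans (ℕP.*-comm b (suc K)) (sym n≡[1+K]*b))
                  (ℕP.*-monoˡ-< (suc K) (subst (ℕ._< b) a%b≡r (ℕD.m%n<n a b)))

  x-0≡x : ∀ x → x - 0# ≡ x
  x-0≡x x = trans (cong (x +_) ε⁻¹≈ε) (+-identityʳ x)

  subgraph⇒powers : ∀ {q d ℓ} → IsSubgraph F q d ℓ →
                    ∀ w → w ≢ 0# → IsPower (suc (q ℕ.^ ℓ)) (w ^ suc (q ℕ.^ d))
  subgraph⇒powers {q} {d} {ℓ} sub w w≢0 = power (sub 0# (w ^ suc A) (w , w≢0 , adjacent))
    where
    A = q ℕ.^ d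
    B = q ℕ.^ ℓ
    _^ᶠ_ = FiniteField._^_ F
    adjacent : w ^ suc A - 0# ≡ w ^ᶠ (A ℕ.+ 1)
    adjacent = begin
      w ^ suc A - 0#    ≡⟨ x-0≡x _ ⟩
      w ^ suc A         ≡⟨ ^-agrees w (suc A) ⟨
      w ^ᶠ suc A        ≡⟨ cong (w ^ᶠ_) (ℕP.+-comm 1 A) ⟩
      w ^ᶠ (A ℕ.+ 1)    ∎
    power : FiniteField.Adj F q ℓ 0# (w ^ suc A) → IsPower (suc B) (w ^ suc A)
    power (z , z≢0 , w^[1+A]-0≡z^[B+1]) = z , z≢0 , (begin
      w ^ suc A         ≡⟨ x-0≡x _ ⟨
      w ^ suc A - 0#    ≡⟨ w^[1+A]-0≡z^[B+1] ⟩
      z ^ᶠ (B ℕ.+ 1)    ≡⟨ cong (z ^ᶠ_) (ℕP.+-comm B 1) ⟩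
      z ^ᶠ suc B        ≡⟨ ^-agrees z (suc B) ⟩
      z ^ suc B         ∎)

subgraph⇒[1+q^ℓ]∣[1+q^d] : ∀ {N} (F : FiniteField N) {q d ℓ} → suc (q ℕ.^ ℓ) ∣ N ℕ.∸ 1 →
                           IsSubgraph F q d ℓ → suc (q ℕ.^ ℓ) ∣ suc (q ℕ.^ d)
subgraph⇒[1+q^ℓ]∣[1+q^d] {zero} F _ _ with Inverse.to (FiniteField.card F) (FiniteField.0# F)
... | ()
subgraph⇒[1+q^ℓ]∣[1+q^d] {suc n} F {q} {d} {ℓ} [1+q^ℓ]∣n sub =
  powers⇒∣ (suc (q ℕ.^ d)) (suc (q ℕ.^ ℓ)) [1+q^ℓ]∣n (subgraph⇒powers {q} {d} {ℓ} sub)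
  where open FiniteFieldFacts F

open import Data.Integer using (+_; -[1+_]; 0ℤ; 1ℤ; _+_; _-_; _*_; -_; _^_)

i*n/ℕn≡i : ∀ i n → (i * + suc n) /ℕ suc n ≡ i
i*n/ℕn≡i (+ zero) n = refl
i*n/ℕn≡i (+ suc k) n = cong +_ (ℕD.m*n/n≡m (suc k) (suc n))
i*n/ℕn≡i -[1+ k ] n with suc (n ℕ.+ k ℕ.* suc n) ℕ.% suc n | ℕD.m*n%n≡0 (suc k) (suc n)
... | .0 | refl = cong (λ j → - (+ j)) (ℕD.m*n/n≡m (suc k) (suc n))

i≡j*n⇒i/ℕn≡j : ∀ {i} j n → i ≡ j * + suc n → i /ℕ suc n ≡ j
i≡j*n⇒i/ℕn≡j j n refl = i*n/ℕn≡i j n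

geometricSum : ℤ → ℕ → ℤ
geometricSum y zero    = 0ℤ
geometricSum y (suc t) = 1ℤ + y * geometricSum y t

y^t-1≡[y-1]*geometricSum : ∀ y t → y ^ t - 1ℤ ≡ (y - 1ℤ) * geometricSum y t
y^t-1≡[y-1]*geometricSum y zero    = sym (ℤP.*-zeroʳ (y - 1ℤ))
y^t-1≡[y-1]*geometricSum y (suc t) = begin
  y * y ^ t - 1ℤ                         ≡⟨ split y (y ^ t) ⟩
  y * (y ^ t - 1ℤ) + (y - 1ℤ)            ≡⟨ cong (λ z → y * z + (y - 1ℤ)) (y^t-1≡[y-1]*geometricSum y t) ⟩
  y * ((y - 1ℤ) * G) + (y - 1ℤ)          ≡⟨ factor y G ⟩
  (y - 1ℤ) * geometricSum y (suc t)      ∎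
  where
  open ≡-Reasoning
  G = geometricSum y t
  split : ∀ y p → y * p - 1ℤ ≡ y * (p - 1ℤ) + (y - 1ℤ)
  split = solve-∀
  factor : ∀ y g → y * ((y - 1ℤ) * g) + (y - 1ℤ) ≡ (y - 1ℤ) * (1ℤ + y * g)
  factor = solve-∀

negOnePow-sign : ∀ t → negOnePow t ≡ 1ℤ ⊎ negOnePow t ≡ - 1ℤ
negOnePow-sign zero    = inj₁ refl
negOnePow-sign (suc t) with negOnePow-sign t
... | inj₁ ε≡1  = inj₂ (cong -_ ε≡1)
... | inj₂ ε≡-1 = inj₁ (cong -_ ε≡-1)

negOnePow-square : ∀ t → negOnePow t * negOnePow t ≡ 1ℤ
negOnePow-square t with negOnePow-sign t
... | inj₁ ε≡1  rewrite ε≡1  = refl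
... | inj₂ ε≡-1 rewrite ε≡-1 = refl

negOnePow*pos^≡neg^ : ∀ b t → negOnePow t * + (b ℕ.^ t) ≡ (- + b) ^ t
negOnePow*pos^≡neg^ b zero    = refl
negOnePow*pos^≡neg^ b (suc t) = begin
  - ε * + (b ℕ.^ suc t)     ≡⟨ cong (- ε *_) (ℤP.pos-* b (b ℕ.^ t)) ⟩
  - ε * (+ b * + (b ℕ.^ t)) ≡⟨ swap ε (+ b) (+ (b ℕ.^ t)) ⟩
  - + b * (ε * + (b ℕ.^ t)) ≡⟨ cong (- + b *_) (negOnePow*pos^≡neg^ b t) ⟩
  - + b * (- + b) ^ t       ∎
  where
  open ≡-Reasoning
  ε = negOnePow t
  swap : ∀ e b p → - e * (b * p) ≡ - b * (e * p)
  swap = solve-∀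

gcd[u,-b*u-1]≡1 : ∀ b u → ℤG.gcd u (- b * u - 1ℤ) ≡ 1ℤ
gcd[u,-b*u-1]≡1 b u = cong +_ (ℕDiv.∣1⇒≡1 (ℤS.∣⇒∣ᵤ g∣1))
  where
  v = - b * u - 1ℤ
  g∣1 : ℤG.gcd u v ℤS.∣ 1ℤ
  g∣1 = subst (ℤG.gcd u v ℤS.∣_) (combination b u)
          (ℤS.∣m∣n⇒∣m-n (ℤS.∣n⇒∣m*n (- b) (ℤS.∣ᵤ⇒∣ (ℤG.gcd[i,j]∣i u v)))
                        (ℤS.∣ᵤ⇒∣ (ℤG.gcd[i,j]∣j u v)))
    where
    combination : ∀ b u → - b * u - (- b * u - 1ℤ) ≡ 1ℤ
    combination = solve-∀

n*[n+1]-even : ∀ n → ∃ λ h → n ℕ.* suc n ≡ h ℕ.* 2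
n*[n+1]-even zero    = 0 , refl
n*[n+1]-even (suc n) with n*[n+1]-even n
... | h , eq = suc n ℕ.+ h , (begin
  suc n ℕ.* suc (suc n)      ≡⟨ expand n ⟩
  n ℕ.* suc n ℕ.+ 2 ℕ.* suc n ≡⟨ cong (ℕ._+ 2 ℕ.* suc n) eq ⟩
  h ℕ.* 2 ℕ.+ 2 ℕ.* suc n     ≡⟨ collect n h ⟩
  (suc n ℕ.+ h) ℕ.* 2         ∎)
  where
  open ≡-Reasoning
  expand : ∀ n → suc n ℕ.* suc (suc n) ≡ n ℕ.* suc n ℕ.+ 2 ℕ.* suc n
  expand = ℕSolver.solve-∀
  collect : ∀ n h → h ℕ.* 2 ℕ.+ 2 ℕ.* suc n ≡ (suc n ℕ.+ h) ℕ.* 2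
  collect = ℕSolver.solve-∀

z*[z+1]≡n*[n+1] : ∀ z → ∃ λ n → z * (z + 1ℤ) ≡ + (n ℕ.* suc n)
z*[z+1]≡n*[n+1] (+ n)    = n , trans (cong (λ k → + n * + k) (ℕP.+-comm n 1)) (sym (ℤP.pos-* n (suc n)))
z*[z+1]≡n*[n+1] -[1+ n ] = n , trans (reflect (+ n)) (proj₂ (z*[z+1]≡n*[n+1] (+ n)))
  where
  reflect : ∀ x → - (1ℤ + x) * (- (1ℤ + x) + 1ℤ) ≡ x * (x + 1ℤ)
  reflect = solve-∀

z*[z+1]-even : ∀ z → ∃ λ h → z * (z + 1ℤ) ≡ h * + 2
z*[z+1]-even z with z*[z+1]≡n*[n+1] z
... | n , z*[z+1]≡n*[n+1] with n*[n+1]-even n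
...   | h , n*[n+1]≡h*2 = + h , trans z*[z+1]≡n*[n+1] (trans (cong +_ n*[n+1]≡h*2) (ℤP.pos-* h 2))

N-1≡k*d⇒d∣N∸1 : ∀ N {d} k → + N - 1ℤ ≡ k * + d → d ∣ N ℕ.∸ 1
N-1≡k*d⇒d∣N∸1 zero    k _  = _ ℕDiv.∣0
N-1≡k*d⇒d∣N∸1 (suc N) k eq = ℤS.∣⇒∣ᵤ (ℤS.divides k eq)

even-quotient : ∀ {m ℓ} .{{_ : NonZero ℓ}} → ℓ ∣ m → 2 ∣ m ℕD./ ℓ → ∃ λ t → m ≡ t ℕ.* 2 ℕ.* ℓ
even-quotient {ℓ = ℓ} (divides j refl) (divides t j*ℓ/ℓ≡t*2) =
  t , cong (ℕ._* ℓ) (trans (sym (ℕD.m*n/n≡m j ℓ)) j*ℓ/ℓ≡t*2)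

module EvenQuotient (q ℓ t : ℕ) .{{_ : NonZero ℓ}} where
  B : ℕ
  B = q ℕ.^ ℓ

  X : ℤ
  X = (- + B) ^ t

  U : ℤ
  U = - geometricSum (- + B) t

  X-1≡U*[1+B] : X - 1ℤ ≡ U * + suc B
  X-1≡U*[1+B] = trans (y^t-1≡[y-1]*geometricSum (- + B) t) (regroup (+ B) (geometricSum (- + B) t))
    where
    regroup : ∀ b g → (- b - 1ℤ) * g ≡ (- g) * (1ℤ + b)
    regroup = solve-∀

  module _ {m : ℕ} (m≡t*2*ℓ : m ≡ t ℕ.* 2 ℕ.* ℓ) where
    m/2≡ℓ*t : m ℕD./ 2 ≡ ℓ ℕ.* t
    m/2≡ℓ*t = trans (cong (ℕD._/ 2) (trans m≡t*2*ℓ (regroup t ℓ))) (ℕD.m*n/n≡m (ℓ ℕ.* t) 2)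
      where
      regroup : ∀ t ℓ → t ℕ.* 2 ℕ.* ℓ ≡ ℓ ℕ.* t ℕ.* 2
      regroup = ℕSolver.solve-∀

    m≡m/2+m/2 : m ≡ m ℕD./ 2 ℕ.+ m ℕD./ 2
    m≡m/2+m/2 = trans m≡t*2*ℓ (trans (regroup t ℓ) (sym (cong₂ ℕ._+_ m/2≡ℓ*t m/2≡ℓ*t)))
      where
      regroup : ∀ t ℓ → t ℕ.* 2 ℕ.* ℓ ≡ ℓ ℕ.* t ℕ.+ ℓ ℕ.* t
      regroup = ℕSolver.solve-∀

    eps≡negOnePow : eps q m ℓ ≡ negOnePow t
    eps≡negOnePow = cong negOnePow (begin
      m ℕD./ ℓ ℕD./ 2            ≡⟨ cong (λ k → k ℕD./ ℓ ℕD./ 2) m≡t*2*ℓ ⟩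
      t ℕ.* 2 ℕ.* ℓ ℕD./ ℓ ℕD./ 2 ≡⟨ cong (ℕD._/ 2) (ℕD.m*n/n≡m (t ℕ.* 2) ℓ) ⟩
      t ℕ.* 2 ℕD./ 2             ≡⟨ ℕD.m*n/n≡m t 2 ⟩
      t                          ∎)
      where open ≡-Reasoning

    eps*q^[m/2]≡X : eps q m ℓ * + (q ℕ.^ (m ℕD./ 2)) ≡ X
    eps*q^[m/2]≡X = begin
      eps q m ℓ * + (q ℕ.^ (m ℕD./ 2)) ≡⟨ cong₂ (λ ε k → ε * + (q ℕ.^ k)) eps≡negOnePow m/2≡ℓ*t ⟩
      negOnePow t * + (q ℕ.^ (ℓ ℕ.* t)) ≡⟨ cong (λ k → negOnePow t * + k) (ℕP.^-*-assoc q ℓ t) ⟨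
      negOnePow t * + (B ℕ.^ t)         ≡⟨ negOnePow*pos^≡neg^ B t ⟩
      X                                 ∎
      where open ≡-Reasoning

    q^m≡X*X : + (q ℕ.^ m) ≡ X * X
    q^m≡X*X = begin
      + (q ℕ.^ m)                              ≡⟨ cong (λ k → + (q ℕ.^ k)) m≡m/2+m/2 ⟩
      + (q ℕ.^ (m ℕD./ 2 ℕ.+ m ℕD./ 2))        ≡⟨ cong +_ (ℕP.^-distribˡ-+-* q (m ℕD./ 2) (m ℕD./ 2)) ⟩
      + (q ℕ.^ (m ℕD./ 2) ℕ.* q ℕ.^ (m ℕD./ 2)) ≡⟨ ℤP.pos-* (q ℕ.^ (m ℕD./ 2)) (q ℕ.^ (m ℕD./ 2)) ⟩
      Q * Q                                    ≡⟨ ℤP.*-identityˡ (Q * Q) ⟨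
      1ℤ * (Q * Q)                             ≡⟨ cong (λ e → e * (Q * Q)) ε*ε≡1 ⟨
      (ε * ε) * (Q * Q)                        ≡⟨ interchange ε Q ⟩
      (ε * Q) * (ε * Q)                        ≡⟨ cong₂ _*_ eps*q^[m/2]≡X eps*q^[m/2]≡X ⟩
      X * X                                    ∎
      where
      open ≡-Reasoning
      ε = eps q m ℓ
      Q = + (q ℕ.^ (m ℕD./ 2))
      ε*ε≡1 : ε * ε ≡ 1ℤ
      ε*ε≡1 = trans (cong₂ _*_ eps≡negOnePow eps≡negOnePow) (negOnePow-square t)
      interchange : ∀ e p → (e * e) * (p * p) ≡ (e * p) * (e * p)
      interchange = solve-∀

    q^m-1≡[X+1]*U*[1+B] : + (q ℕ.^ m) - 1ℤ ≡ ((X + 1ℤ) * U) * + suc B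
    q^m-1≡[X+1]*U*[1+B] = begin
      + (q ℕ.^ m) - 1ℤ            ≡⟨ cong (_- 1ℤ) q^m≡X*X ⟩
      X * X - 1ℤ                  ≡⟨ difference-of-squares X ⟩
      (X + 1ℤ) * (X - 1ℤ)         ≡⟨ cong ((X + 1ℤ) *_) X-1≡U*[1+B] ⟩
      (X + 1ℤ) * (U * + suc B)    ≡⟨ ℤP.*-assoc (X + 1ℤ) U (+ suc B) ⟨
      ((X + 1ℤ) * U) * + suc B    ∎
      where
      open ≡-Reasoning
      difference-of-squares : ∀ x → x * x - 1ℤ ≡ (x + 1ℤ) * (x - 1ℤ)
      difference-of-squares = solve-∀

    [1+B]∣q^m∸1 : suc B ∣ q ℕ.^ m ℕ.∸ 1
    [1+B]∣q^m∸1 = N-1≡k*d⇒d∣N∸1 (q ℕ.^ m) ((X + 1ℤ) * U) q^m-1≡[X+1]*U*[1+B]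

    kval≡[X+1]*U : kval q m ℓ ≡ (X + 1ℤ) * U
    kval≡[X+1]*U = i≡j*n⇒i/ℕn≡j _ B q^m-1≡[X+1]*U*[1+B]

    upsilon≡U : upsilon q m ℓ ≡ U
    upsilon≡U = trans (cong (λ x → (x - 1ℤ) /ℕ suc B) eps*q^[m/2]≡X) (i≡j*n⇒i/ℕn≡j U B X-1≡U*[1+B])

    mu≡-B*U-1 : mu q m ℓ ≡ - + B * U - 1ℤ
    mu≡-B*U-1 = trans (cong (λ x → (- x - 1ℤ) /ℕ suc B) eps*q^[m/2+ℓ]≡X*B) (i≡j*n⇒i/ℕn≡j _ B numerator)
      where
      open ≡-Reasoning
      eps*q^[m/2+ℓ]≡X*B : eps q m ℓ * + (q ℕ.^ (m ℕD./ 2 ℕ.+ ℓ)) ≡ X * + B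
      eps*q^[m/2+ℓ]≡X*B = begin
        ε * + (q ℕ.^ (m ℕD./ 2 ℕ.+ ℓ))     ≡⟨ cong (λ k → ε * + k) (ℕP.^-distribˡ-+-* q (m ℕD./ 2) ℓ) ⟩
        ε * + (q ℕ.^ (m ℕD./ 2) ℕ.* B)     ≡⟨ cong (ε *_) (ℤP.pos-* (q ℕ.^ (m ℕD./ 2)) B) ⟩
        ε * (+ (q ℕ.^ (m ℕD./ 2)) * + B)   ≡⟨ ℤP.*-assoc ε _ (+ B) ⟨
        ε * + (q ℕ.^ (m ℕD./ 2)) * + B     ≡⟨ cong (_* + B) eps*q^[m/2]≡X ⟩
        X * + B                            ∎
        where ε = eps q m ℓ
      numerator : - (X * + B) - 1ℤ ≡ (- + B * U - 1ℤ) * + suc B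
      numerator = begin
        - (X * + B) - 1ℤ                      ≡⟨ split X (+ B) ⟩
        - + B * (X - 1ℤ) - (1ℤ + + B)         ≡⟨ cong (λ e → - + B * e - (1ℤ + + B)) X-1≡U*[1+B] ⟩
        - + B * (U * + suc B) - (1ℤ + + B)    ≡⟨ factor (+ B) U ⟩
        (- + B * U - 1ℤ) * + suc B            ∎
        where
        split : ∀ x b → - (x * b) - 1ℤ ≡ - b * (x - 1ℤ) - (1ℤ + b)
        split = solve-∀
        factor : ∀ b u → - b * (u * (1ℤ + b)) - (1ℤ + b) ≡ (- b * u - 1ℤ) * (1ℤ + b)
        factor = solve-∀

eigenvalue-relations : ∀ q m ℓ .{{_ : NonZero ℓ}} → ℓ ∣ m → 2 ∣ m ℕD./ ℓ →
  (kval q m ℓ ≡ (eps q m ℓ * + (q ℕ.^ (m ℕD./ 2)) + 1ℤ) * upsilon q m ℓ)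
  × (- (+ (q ℕ.^ ℓ)) * upsilon q m ℓ ≡ mu q m ℓ + 1ℤ)
  × (ℤG.gcd (upsilon q m ℓ) (mu q m ℓ) ≡ 1ℤ)
eigenvalue-relations q m ℓ ℓ∣m 2∣m/ℓ with even-quotient ℓ∣m 2∣m/ℓ
... | t , m≡t*2*ℓ =
    trans (kval≡[X+1]*U m≡t*2*ℓ)
          (sym (cong₂ (λ x u → (x + 1ℤ) * u) (eps*q^[m/2]≡X m≡t*2*ℓ) (upsilon≡U m≡t*2*ℓ)))
  , trans (cong (- + B *_) (upsilon≡U m≡t*2*ℓ))
          (trans (add-one (+ B) U) (cong (_+ 1ℤ) (sym (mu≡-B*U-1 m≡t*2*ℓ))))
  , trans (cong₂ ℤG.gcd (upsilon≡U m≡t*2*ℓ) (mu≡-B*U-1 m≡t*2*ℓ)) (gcd[u,-b*u-1]≡1 (+ B) U)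
  where
  open EvenQuotient q ℓ t
  add-one : ∀ b u → - b * u ≡ (- b * u - 1ℤ) + 1ℤ
  add-one = solve-∀

upsilon-shift : ∀ q ℓ M .{{_ : NonZero ℓ}} → ℓ ∣ M →
                upsilon q (2 ℕ.* M ℕ.+ 2 ℕ.* ℓ) ℓ ≡ mu q (2 ℕ.* M) ℓ
upsilon-shift q ℓ .(s ℕ.* ℓ) (divides s refl) = begin
  upsilon q (2 ℕ.* (s ℕ.* ℓ) ℕ.+ 2 ℕ.* ℓ) ℓ  ≡⟨ Shifted.upsilon≡U (shifted s ℓ) ⟩
  Shifted.U                                ≡⟨ step (- + B) (geometricSum (- + B) s) ⟩
  - + B * Unshifted.U - 1ℤ                 ≡⟨ Unshifted.mu≡-B*U-1 (unshifted s ℓ) ⟨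
  mu q (2 ℕ.* (s ℕ.* ℓ)) ℓ                 ∎
  where
  open ≡-Reasoning
  module Shifted   = EvenQuotient q ℓ (suc s)
  module Unshifted = EvenQuotient q ℓ s
  B = q ℕ.^ ℓ
  shifted : ∀ s ℓ → 2 ℕ.* (s ℕ.* ℓ) ℕ.+ 2 ℕ.* ℓ ≡ suc s ℕ.* 2 ℕ.* ℓ
  shifted = ℕSolver.solve-∀
  unshifted : ∀ s ℓ → 2 ℕ.* (s ℕ.* ℓ) ≡ s ℕ.* 2 ℕ.* ℓ
  unshifted = ℕSolver.solve-∀
  step : ∀ y g → - (1ℤ + y * g) ≡ y * (- g) - 1ℤ
  step = solve-∀

negOnePow-agree : ∀ s t → negOnePow s ≡ negOnePow t ⊎ negOnePow s ≡ - negOnePow t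
negOnePow-agree s t with negOnePow-sign s | negOnePow-sign t
... | inj₁ εs≡1  | inj₁ εt≡1  = inj₁ (trans εs≡1 (sym εt≡1))
... | inj₂ εs≡-1 | inj₂ εt≡-1 = inj₁ (trans εs≡-1 (sym εt≡-1))
... | inj₁ εs≡1  | inj₂ εt≡-1 = inj₂ (trans εs≡1 (sym (cong -_ εt≡-1)))
... | inj₂ εs≡-1 | inj₁ εt≡1  = inj₂ (trans εs≡-1 (cong -_ (sym εt≡1)))

∣x-1∧∣-x-1⇒∣2 : ∀ {n x} → n ℤS.∣ x - 1ℤ → n ℤS.∣ - x - 1ℤ → n ℤS.∣ + 2
∣x-1∧∣-x-1⇒∣2 {n} {x} n∣x-1 n∣-x-1 =
  subst (n ℤS.∣_) (sum x) (ℤS.∣m⇒∣-m (ℤS.∣m∣n⇒∣m+n n∣x-1 n∣-x-1))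
  where
  sum : ∀ x → - ((x - 1ℤ) + (- x - 1ℤ)) ≡ + 2
  sum = solve-∀

module PairOfDivisors (q m d ℓ td tℓ : ℕ) .{{_ : NonZero d}} .{{_ : NonZero ℓ}}
                       (m≡td*2*d : m ≡ td ℕ.* 2 ℕ.* d) (m≡tℓ*2*ℓ : m ≡ tℓ ℕ.* 2 ℕ.* ℓ) where
  module D = EvenQuotient q d td
  module L = EvenQuotient q ℓ tℓ

  Q : ℤ
  Q = + (q ℕ.^ (m ℕD./ 2))

  Xd≡εd*Q : D.X ≡ negOnePow td * Q
  Xd≡εd*Q = trans (sym (D.eps*q^[m/2]≡X m≡td*2*d)) (cong (_* Q) (D.eps≡negOnePow m≡td*2*d))

  Xℓ≡εℓ*Q : L.X ≡ negOnePow tℓ * Q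
  Xℓ≡εℓ*Q = trans (sym (L.eps*q^[m/2]≡X m≡tℓ*2*ℓ)) (cong (_* Q) (L.eps≡negOnePow m≡tℓ*2*ℓ))

  Xd≡Xℓ⊎Xd≡-Xℓ : D.X ≡ L.X ⊎ D.X ≡ - L.X
  Xd≡Xℓ⊎Xd≡-Xℓ with negOnePow-agree td tℓ
  ... | inj₁ εd≡εℓ  = inj₁ (trans Xd≡εd*Q (trans (cong (_* Q) εd≡εℓ) (sym Xℓ≡εℓ*Q)))
  ... | inj₂ εd≡-εℓ = inj₂ (trans Xd≡εd*Q (trans (cong (_* Q) εd≡-εℓ)
                            (trans (sym (ℤP.neg-distribˡ-* (negOnePow tℓ) Q)) (cong -_ (sym Xℓ≡εℓ*Q)))))

  module Scaling {c : ℕ} (1+A≡c*[1+B] : suc D.B ≡ c ℕ.* suc L.B) (1<B : 1 ℕ.< L.B) where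
    open ≡-Reasoning

    Xd≡Xℓ : D.X ≡ L.X
    Xd≡Xℓ with Xd≡Xℓ⊎Xd≡-Xℓ
    ... | inj₁ Xd≡Xℓ  = Xd≡Xℓ
    ... | inj₂ Xd≡-Xℓ = ⊥-elim (ℕP.<⇒≱ (ℕ.s≤s 1<B) (ℕDiv.∣⇒≤ (ℤS.∣⇒∣ᵤ [1+B]∣2)))
      where
      [1+B]∣[1+A] : + suc L.B ℤS.∣ + suc D.B
      [1+B]∣[1+A] = ℤS.divides (+ c) (trans (cong +_ 1+A≡c*[1+B]) (ℤP.pos-* c (suc L.B)))
      [1+B]∣-Xℓ-1 : + suc L.B ℤS.∣ - L.X - 1ℤ
      [1+B]∣-Xℓ-1 = ℤS.∣-trans [1+B]∣[1+A]
                      (ℤS.divides D.U (trans (cong (λ x → x - 1ℤ) (sym Xd≡-Xℓ)) D.X-1≡U*[1+B]))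
      [1+B]∣2 : + suc L.B ℤS.∣ + 2
      [1+B]∣2 = ∣x-1∧∣-x-1⇒∣2 {x = L.X} (ℤS.divides L.U L.X-1≡U*[1+B]) [1+B]∣-Xℓ-1

    Uℓ≡c*Ud : L.U ≡ + c * D.U
    Uℓ≡c*Ud = ℤP.*-cancelʳ-≡ L.U (+ c * D.U) (+ suc L.B) (begin
      L.U * + suc L.B             ≡⟨ L.X-1≡U*[1+B] ⟨
      L.X - 1ℤ                    ≡⟨ cong (_- 1ℤ) Xd≡Xℓ ⟨
      D.X - 1ℤ                    ≡⟨ D.X-1≡U*[1+B] ⟩
      D.U * + suc D.B             ≡⟨ cong (λ k → D.U * + k) 1+A≡c*[1+B] ⟩
      D.U * + (c ℕ.* suc L.B)     ≡⟨ cong (D.U *_) (ℤP.pos-* c (suc L.B)) ⟩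
      D.U * (+ c * + suc L.B)     ≡⟨ regroup D.U (+ c) (+ suc L.B) ⟩
      (+ c * D.U) * + suc L.B     ∎)
      where
      regroup : ∀ u c b → u * (c * b) ≡ (c * u) * b
      regroup = solve-∀

    upsilon-scales : upsilon q m ℓ ≡ + c * upsilon q m d
    upsilon-scales = begin
      upsilon q m ℓ        ≡⟨ L.upsilon≡U m≡tℓ*2*ℓ ⟩
      L.U                  ≡⟨ Uℓ≡c*Ud ⟩
      + c * D.U            ≡⟨ cong (+ c *_) (D.upsilon≡U m≡td*2*d) ⟨
      + c * upsilon q m d  ∎

    kval-scales : kval q m ℓ ≡ + c * kval q m d
    kval-scales = begin
      kval q m ℓ               ≡⟨ L.kval≡[X+1]*U m≡tℓ*2*ℓ ⟩
      (L.X + 1ℤ) * L.U         ≡⟨ cong₂ (λ x u → (x + 1ℤ) * u) Xd≡Xℓ (sym Uℓ≡c*Ud) ⟨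
      (D.X + 1ℤ) * (+ c * D.U) ≡⟨ regroup (D.X + 1ℤ) (+ c) D.U ⟩
      + c * ((D.X + 1ℤ) * D.U) ≡⟨ cong (+ c *_) (D.kval≡[X+1]*U m≡td*2*d) ⟨
      + c * kval q m d         ∎
      where
      regroup : ∀ x c u → x * (c * u) ≡ c * (x * u)
      regroup = solve-∀

    edges-scales : edges q m ℓ ≡ + c * edges q m d
    edges-scales = begin
      edges q m ℓ                        ≡⟨ i≡j*n⇒i/ℕn≡j (+ c * H) 1 q^m*kℓ≡c*H*2 ⟩
      + c * H                            ≡⟨ cong (+ c *_) (i≡j*n⇒i/ℕn≡j H 1 q^m*kd≡H*2) ⟨
      + c * edges q m d                  ∎
      where
      h = proj₁ (z*[z+1]-even D.X)
      H = h * (D.X * D.U)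
      q^m*kd≡H*2 : + (q ℕ.^ m) * kval q m d ≡ H * + 2
      q^m*kd≡H*2 = begin
        + (q ℕ.^ m) * kval q m d             ≡⟨ cong₂ _*_ (D.q^m≡X*X m≡td*2*d) (D.kval≡[X+1]*U m≡td*2*d) ⟩
        (D.X * D.X) * ((D.X + 1ℤ) * D.U)     ≡⟨ regroup D.X D.U ⟩
        (D.X * (D.X + 1ℤ)) * (D.X * D.U)     ≡⟨ cong (_* (D.X * D.U)) (proj₂ (z*[z+1]-even D.X)) ⟩
        (h * + 2) * (D.X * D.U)              ≡⟨ swap h (D.X * D.U) ⟩
        H * + 2                              ∎
        where
        regroup : ∀ x u → (x * x) * ((x + 1ℤ) * u) ≡ (x * (x + 1ℤ)) * (x * u)
        regroup = solve-∀
        swap : ∀ h y → (h * + 2) * y ≡ (h * y) * + 2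
        swap = solve-∀
      q^m*kℓ≡c*H*2 : + (q ℕ.^ m) * kval q m ℓ ≡ (+ c * H) * + 2
      q^m*kℓ≡c*H*2 = begin
        + (q ℕ.^ m) * kval q m ℓ             ≡⟨ cong (+ (q ℕ.^ m) *_) kval-scales ⟩
        + (q ℕ.^ m) * (+ c * kval q m d)     ≡⟨ regroup (+ (q ℕ.^ m)) (+ c) (kval q m d) ⟩
        + c * (+ (q ℕ.^ m) * kval q m d)     ≡⟨ cong (+ c *_) q^m*kd≡H*2 ⟩
        + c * (H * + 2)                      ≡⟨ ℤP.*-assoc (+ c) H (+ 2) ⟨
        (+ c * H) * + 2                      ∎
        where
        regroup : ∀ p c k → p * (c * k) ≡ c * (p * k)
        regroup = solve-∀

subgraph-divisibility : ∀ q m d ℓ .{{_ : NonZero d}} .{{_ : NonZero ℓ}} → 1 ℕ.< q →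
  d ∣ m → 2 ∣ m ℕD./ d → ℓ ∣ m → 2 ∣ m ℕD./ ℓ → (F : FiniteField (q ℕ.^ m)) → IsSubgraph F q d ℓ →
  (kval q m d ℤDiv.∣ kval q m ℓ) × (upsilon q m d ℤDiv.∣ upsilon q m ℓ) × (edges q m d ℤDiv.∣ edges q m ℓ)
subgraph-divisibility q m d ℓ 1<q d∣m 2∣m/d ℓ∣m 2∣m/ℓ F sub
  with even-quotient d∣m 2∣m/d | even-quotient ℓ∣m 2∣m/ℓ
... | td , m≡td*2*d | tℓ , m≡tℓ*2*ℓ
  with subgraph⇒[1+q^ℓ]∣[1+q^d] F {q} {d} {ℓ} (EvenQuotient.[1+B]∣q^m∸1 q ℓ tℓ m≡tℓ*2*ℓ) sub
... | divides c 1+A≡c*[1+B] =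
  scaled kval-scales , scaled upsilon-scales , scaled edges-scales
  where
  open PairOfDivisors.Scaling q m d ℓ td tℓ m≡td*2*d m≡tℓ*2*ℓ {c} 1+A≡c*[1+B]
         (ℕP.^-monoʳ-< q 1<q (ℕ.>-nonZero⁻¹ ℓ))
  scaled : ∀ {i j} → j ≡ + c * i → i ℤDiv.∣ j
  scaled j≡c*i = ℤS.∣⇒∣ᵤ (ℤS.divides (+ c) j≡c*i)

prime-power⇒1<q : ∀ {q} → IsPrimePower q → 1 ℕ.< q
prime-power⇒1<q (p , e , p-prime , 1≤e , refl) =
  ℕP.^-monoʳ-< p (ℕ.nonTrivial⇒n>1 p {{prime⇒nonTrivial p-prime}}) 1≤e

corollary3p7 :
    -- (a)
    ((q m ℓ : ℕ) → .{{_ : NonZero ℓ}} → IsPrimePower q → 2 ≤ m →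
      ℓ ℕDiv.∣ m → 2 ℕDiv.∣ (m ℕD./ ℓ) →
        (kval q m ℓ ≡ (eps q m ℓ ℤ.* + (q ℕ.^ (m ℕD./ 2)) ℤ.+ 1ℤ) ℤ.* upsilon q m ℓ)
        × (ℤ.- (+ (q ℕ.^ ℓ)) ℤ.* upsilon q m ℓ ≡ mu q m ℓ ℤ.+ 1ℤ)
        × (ℤG.gcd (upsilon q m ℓ) (mu q m ℓ) ≡ 1ℤ))
    ×
    -- (b)
    ((q ℓ M : ℕ) → .{{_ : NonZero ℓ}} → IsPrimePower q → 1 ≤ M → ℓ ℕDiv.∣ M →
      upsilon q (2 ℕ.* M ℕ.+ 2 ℕ.* ℓ) ℓ ≡ mu q (2 ℕ.* M) ℓ)
    ×
    -- (c)
    ((q m d ℓ : ℕ) → .{{_ : NonZero d}} → .{{_ : NonZero ℓ}} → IsPrimePower q → 2 ≤ m →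
      d ℕDiv.∣ m → 2 ℕDiv.∣ (m ℕD./ d) → ℓ ℕDiv.∣ m → 2 ℕDiv.∣ (m ℕD./ ℓ) →
      (F : FiniteField (q ℕ.^ m)) → IsSubgraph F q d ℓ →
        (kval q m d ℤDiv.∣ kval q m ℓ)
        × (upsilon q m d ℤDiv.∣ upsilon q m ℓ)
        × (edges q m d ℤDiv.∣ edges q m ℓ))
corollary3p7 =
    (λ q m ℓ _ _ → eigenvalue-relations q m ℓ)
  , (λ q ℓ M _ _ → upsilon-shift q ℓ M)
  , (λ q m d ℓ q-prime-power _ → subgraph-divisibility q m d ℓ (prime-power⇒1<q q-prime-power))
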